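{- Let $G$ be a stack branching program of size $s$. Then there is a stack branching program $G'$ of size $O(s^2)$ such that $G$ and $G'$ compute the same polynomial and $G'$ contains no $\mathrm{nop}$-edges. If $G$ is layered of width $k$, then $G'$ is layered as well and has width at most $k^2$.
   Context: Stack branching programs (SBPs): Let $S$ be a finite symbol set. Stack operations are $\mathrm{push}(s)$, $\mathrm{pop}(s)$ for $s\in S$, and $\mathrm{nop}$. Realizable sequences are defined inductively: the empty sequence is realizable; if $P$ is realizable then $\mathrm{push}(s)P\,\mathrm{pop}(s)$, $\mathrm{nop}\,P$ and $P\,\mathrm{nop}$ are realizable; if $P,Q$ are realizable so is $PQ$. An SBP over a field $\mathbb{F}$ is a DAG with distinguished vertices $s,t$, an edge weight labeling $w:E\to\mathbb{F}\cup\{X_1,X_2,\dots\}$ and an edge labeling $\sigma$ by stack operations. A path is stack-realizable if its sequence of edge operations is realizable; its weight is the product of its edge weights. The SBP computes $\sum_P w(P)$ over stack-realizable $s$-$t$-paths. Size = number of vertices. A $\mathrm{nop}$-edge is an edge $e$ with $\sigma(e)=\mathrm{nop}$. An SBP is layered of width $k$ if its vertices are partitioned into layers $L_i$, $i\in\mathbb{N}$, with edges only from $L_i$ to $L_{i+1}$ and each layer having at most $k$ vertices. -}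

module Defs where

open import Level using (Level; _⊔_; suc)
open import Algebra.Bundles using (CommutativeRing)
open import Data.Nat as ℕ using (ℕ; _≤_)
open import Data.Fin using (Fin)
open import Data.Fin.Properties using (_≟_)
open import Data.List using (List; []; _∷_; map; foldr; length; filter)
open import Data.List.Membership.Propositional using (_∈_)
open import Data.List.Relation.Unary.Unique.Propositional using (Unique)
open import Data.Bool using (Bool; true)
open import Data.Product using (Σ; ∃; _×_; _,_)
open import Relation.Nullary using (¬_)
open import Relation.Binary.PropositionalEquality using (_≡_)
open import Function.Bundles using (_⇔_)
import Data.Nat.Properties as ℕP
import Data.List

record Field (c ℓ : Level) : Set (suc (c ⊔ ℓ)) where
  field
    commutativeRing : CommutativeRing c ℓ
  open CommutativeRing commutativeRing public
  field
    0≉1     : ¬ (0# ≈ 1#)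
    inverse : ∀ x → ¬ (x ≈ 0#) → ∃ λ y → (x * y) ≈ 1#

-- The polynomial ring F[X₁, X₂, …], as the free commutative F-algebra on
-- the variables X_i (i : ℕ): formal expressions modulo the congruence
-- generated by the commutative-ring axioms and the identification of
-- constants with field elements.

module Polynomials {c ℓ : Level} (F : Field c ℓ) where
  private module F = Field F

  infixl 6 _⊕_
  infixl 7 _⊗_
  infix  4 _≈P_

  data Poly : Set c where
    con : F.Carrier → Poly
    var : ℕ → Poly
    _⊕_ : Poly → Poly → Poly
    _⊗_ : Poly → Poly → Poly

  data _≈P_ : Poly → Poly → Set (c ⊔ ℓ) where
    ≈refl  : ∀ {p} → p ≈P p
    ≈sym   : ∀ {p q} → p ≈P q → q ≈P p
    ≈trans : ∀ {p q r} → p ≈P q → q ≈P r → p ≈P r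
    ⊕-cong : ∀ {p p' q q'} → p ≈P p' → q ≈P q' → p ⊕ q ≈P p' ⊕ q'
    ⊗-cong : ∀ {p p' q q'} → p ≈P p' → q ≈P q' → p ⊗ q ≈P p' ⊗ q'
    ⊕-assoc  : ∀ p q r → (p ⊕ q) ⊕ r ≈P p ⊕ (q ⊕ r)
    ⊕-comm   : ∀ p q → p ⊕ q ≈P q ⊕ p
    ⊕-idˡ    : ∀ p → con F.0# ⊕ p ≈P p
    ⊕-invˡ   : ∀ p → (con (F.- F.1#) ⊗ p) ⊕ p ≈P con F.0#
    ⊗-assoc  : ∀ p q r → (p ⊗ q) ⊗ r ≈P p ⊗ (q ⊗ r)
    ⊗-comm   : ∀ p q → p ⊗ q ≈P q ⊗ p
    ⊗-idˡ    : ∀ p → con F.1# ⊗ p ≈P p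
    distribˡ : ∀ p q r → p ⊗ (q ⊕ r) ≈P (p ⊗ q) ⊕ (p ⊗ r)
    con-cong : ∀ {a b} → a F.≈ b → con a ≈P con b
    con-+    : ∀ a b → con a ⊕ con b ≈P con (a F.+ b)
    con-*    : ∀ a b → con a ⊗ con b ≈P con (a F.* b)

data Op (S : Set) : Set where
  push : S → Op S
  pop  : S → Op S
  nop  : Op S

data Realizable {S : Set} : List (Op S) → Set where
  empty   : Realizable []
  wrap    : ∀ s {P} → Realizable P → Realizable (push s ∷ (P Data.List.++ (pop s ∷ [])))
  nopˡ    : ∀ {P} → Realizable P → Realizable (nop ∷ P)
  nopʳ    : ∀ {P} → Realizable P → Realizable (P Data.List.++ (nop ∷ []))
  concat  : ∀ {P Q} → Realizable P → Realizable Q → Realizable (P Data.List.++ Q)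

data Weight {c ℓ : Level} (F : Field c ℓ) : Set c where
  const : Field.Carrier F → Weight F
  X     : ℕ → Weight F

module _ {n : ℕ} (adj : Fin n → Fin n → Bool) where
  -- IsWalk u ws v : the vertex sequence u ∷ ws is a directed walk from u to v.
  data IsWalk : Fin n → List (Fin n) → Fin n → Set where
    here : ∀ {u} → IsWalk u [] u
    step : ∀ {u w ws v} → adj u w ≡ true → IsWalk w ws v → IsWalk u (w ∷ ws) v

edgesOf : ∀ {n} → Fin n → List (Fin n) → List (Fin n × Fin n)
edgesOf u []       = []
edgesOf u (w ∷ ws) = (u , w) ∷ edgesOf w ws

-- A (simple) directed graph on vertices Fin size, edge set given by adj,
-- with edge weights w and stack-operation labels σ (values on non-edges
-- are irrelevant), symbol set Fin symbols, source src, sink tgt, acyclic.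
record SBP {c ℓ : Level} (F : Field c ℓ) : Set c where
  field
    size    : ℕ
    symbols : ℕ
    src tgt : Fin size
    adj     : Fin size → Fin size → Bool
    w       : Fin size → Fin size → Weight F
    σ       : Fin size → Fin size → Op (Fin symbols)
    acyclic : ∀ v ws → IsWalk adj v ws v → ws ≡ []

module _ {c ℓ : Level} {F : Field c ℓ} (G : SBP F) where
  open SBP G
  open Polynomials F

  weightPoly : Weight F → Poly
  weightPoly (const a) = con a
  weightPoly (X i)     = var i

  opsOf : List (Fin size) → List (Op (Fin symbols))
  opsOf ws = map (λ e → σ (Data.Product.proj₁ e) (Data.Product.proj₂ e)) (edgesOf src ws)

  pathWeight : List (Fin size) → Poly
  pathWeight ws = foldr (λ e p → weightPoly (w (Data.Product.proj₁ e) (Data.Product.proj₂ e)) ⊗ p)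
                        (con (Field.1# F)) (edgesOf src ws)

  StackRealizablePath : List (Fin size) → Set
  StackRealizablePath ws = IsWalk adj src ws tgt × Realizable (opsOf ws)

  sumPoly : List Poly → Poly
  sumPoly = foldr _⊕_ (con (Field.0# F))

  -- G computes p: p is the sum of the weights of all stack-realizable
  -- src-tgt paths (enumerated without repetition by the list L).
  Computes : Poly → Set (c ⊔ ℓ)
  Computes p = Σ (List (List (Fin size))) λ L →
                 Unique L
               × (∀ ws → StackRealizablePath ws ⇔ ws ∈ L)
               × p ≈P sumPoly (map pathWeight L)

  NoNopEdges : Set
  NoNopEdges = ∀ u v → adj u v ≡ true → ¬ (σ u v ≡ nop)

  Layered : ℕ → Set
  Layered k = Σ (Fin size → ℕ) λ layer →
                (∀ u v → adj u v ≡ true → layer v ≡ ℕ.suc (layer u))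
              × (∀ i → length (filter (λ v → layer v ℕP.≟ i) (Data.List.allFin size)) ≤ k)

SameFunction : ∀ {c ℓ} {F : Field c ℓ} → SBP F → SBP F → Set (c ⊔ ℓ)
SameFunction {F = F} G G' = ∀ (p : Polynomials.Poly F) → (Computes G p → Computes G' p) × (Computes G' p → Computes G p)

module Submission where

-- Every edge u → v of G is replaced by a path u → ⟨u,v⟩ → v through a fresh
-- midpoint vertex, one for each ordered pair of vertices, so G' has
-- s + s² ≤ 2s² vertices.  The stack alphabet gets a fresh marker symbol 0 and
-- each operation becomes a pair of non-nop operations:
--   push s ↦ push (s+1) push 0,   pop s ↦ pop 0 pop (s+1),   nop ↦ push 0 pop 0.
-- The file first characterises realizable sequences by a deterministic stack
-- machine (StackMachine), which makes it easy to show that the encoding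
-- preserves and reflects realizability (NopFreeEncoding).

open import Defs
open import Level using (Level)
open import Data.Nat using (ℕ; _≤_; _*_)
open import Data.Product using (Σ; _×_)

import Data.Nat as ℕ
open import Data.Nat using (suc; _+_; _∸_; _<_; z≤n; s≤s; >-nonZero)
open import Data.Nat.Properties
  using (≤-trans; ≤-reflexive; suc-injective; *-cancelʳ-≡; *-comm; even≢odd; <⇒≱; ≰⇒>; m≤m+n; m≤m*n;
         m+n∸m≡n; *-mono-≤; +-monoˡ-≤; +-identityʳ; module ≤-Reasoning)
open import Data.Fin using (Fin; zero; suc; toℕ; splitAt; join; remQuot; combine)
open import Data.Fin.Properties
  using (_≟_; toℕ-injective; splitAt-join; join-splitAt; remQuot-combine; combine-remQuot)
open import Data.Bool using (Bool; true; false; _∧_; if_then_else_)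
open import Data.List using (List; []; _∷_; _++_; map; foldr; filter; allFin; length; cartesianProduct)
open import Data.List.Properties using (++-assoc; ∷-injective; ++-conicalʳ; length-++; length-map)
open import Data.List.Extrema.Nat using (max; xs≤max)
open import Data.List.Membership.Propositional using (_∈_)
open import Data.List.Membership.Propositional.Properties
  using (∈-map⁺; ∈-map⁻; ∈-∃++; ∈-++⁻; ∈-++⁺ˡ; ∈-++⁺ʳ; ∈-filter⁺; ∈-filter⁻; ∈-allFin; ∈-cartesianProduct⁺)
open import Data.List.Relation.Unary.Any using (here; there)
open import Data.List.Relation.Unary.All using (lookup)
open import Data.List.Relation.Unary.AllPairs using (_∷_)
open import Data.List.Relation.Unary.Unique.Propositional using (Unique)
import Data.List.Relation.Unary.Unique.Propositional.Properties as Unique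
open import Data.List.Relation.Binary.Subset.Propositional using (_⊆_)
open import Data.Maybe using (Maybe; just; nothing)
import Data.Maybe as Maybe
open import Data.Maybe.Properties using (just-injective)
open import Data.Sum using (_⊎_; inj₁; inj₂)
import Data.Sum as Sum
open import Data.Product using (∃; _,_; proj₁; proj₂; uncurry)
open import Data.Empty using (⊥-elim)
open import Function using (Injective)
open import Function.Bundles using (_⇔_; mk⇔; Equivalence)
open import Relation.Nullary using (¬_; yes; no; does)
open import Relation.Nullary.Decidable using (dec-true)
open import Relation.Unary using (Pred; Decidable)
open import Relation.Binary.Definitions using (DecidableEquality)
open import Relation.Binary.PropositionalEquality

-- A deterministic stack machine over an alphabet with decidable equality.
-- A sequence is realizable exactly when it runs from the empty stack back
-- to the empty stack.
module StackMachine {S : Set} (_≟ₛ_ : DecidableEquality S) where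

  Stack : Set
  Stack = List S

  run : Stack → List (Op S) → Maybe Stack
  run st       []           = just st
  run st       (push s ∷ P) = run (s ∷ st) P
  run st       (nop ∷ P)    = run st P
  run []       (pop s ∷ P)  = nothing
  run (t ∷ st) (pop s ∷ P)  = if does (s ≟ₛ t) then run st P else nothing

  run-pop-top : ∀ s st P → run (s ∷ st) (pop s ∷ P) ≡ run st P
  run-pop-top s st P rewrite dec-true (s ≟ₛ s) refl = refl

  run-++ : ∀ st {st'} P Q → run st P ≡ just st' → run st (P ++ Q) ≡ run st' Q
  run-++ st       []           Q refl = refl
  run-++ st       (push s ∷ P) Q e    = run-++ (s ∷ st) P Q e
  run-++ st       (nop ∷ P)    Q e    = run-++ st P Q e
  run-++ []       (pop s ∷ P)  Q ()
  run-++ (t ∷ st) (pop s ∷ P)  Q e with s ≟ₛ t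
  run-++ (t ∷ st) (pop s ∷ P)  Q e  | yes _ = run-++ st P Q e
  run-++ (t ∷ st) (pop s ∷ P)  Q () | no  _

  realizable⇒run : ∀ {P} → Realizable P → ∀ st → run st P ≡ just st
  realizable⇒run empty st = refl
  realizable⇒run (wrap s {P} R) st = begin
    run st (push s ∷ P ++ pop s ∷ []) ≡⟨ run-++ (s ∷ st) P (pop s ∷ []) (realizable⇒run R (s ∷ st)) ⟩
    run (s ∷ st) (pop s ∷ [])        ≡⟨ run-pop-top s st [] ⟩
    just st                          ∎
    where open ≡-Reasoning
  realizable⇒run (nopˡ R) st = realizable⇒run R st
  realizable⇒run (nopʳ {P} R) st = run-++ st P (nop ∷ []) (realizable⇒run R st)
  realizable⇒run (concat {P} {Q} R R') st =
    trans (run-++ st P Q (realizable⇒run R st)) (realizable⇒run R' st)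

  -- Closes st P: P empties the stack st, i.e. it has the shape
  -- R₀ pop(s₁) R₁ … pop(sₙ) Rₙ with st = s₁ … sₙ and all Rᵢ realizable.
  data Closes : Stack → List (Op S) → Set where
    closed : ∀ {P} → Realizable P → Closes [] P
    popped : ∀ {s st R Q} → Realizable R → Closes st Q → Closes (s ∷ st) (R ++ pop s ∷ Q)

  closes-prepend : ∀ {st R Q} → Realizable R → Closes st Q → Closes st (R ++ Q)
  closes-prepend RR (closed RQ) = closed (concat RR RQ)
  closes-prepend {R = R} RR (popped {s} {R = R₀} {Q} R₀R C) =
    subst (Closes _) (++-assoc R R₀ (pop s ∷ Q)) (popped (concat RR R₀R) C)

  run⇒closes : ∀ st P → run st P ≡ just [] → Closes st P
  run⇒closes st []           e with refl ← just-injective e = closed empty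
  run⇒closes st (push s ∷ P) e with run⇒closes (s ∷ st) P e
  ... | popped {R = R} {Q} RR C =
    subst (Closes st) (++-assoc (push s ∷ R) (pop s ∷ []) Q) (closes-prepend (wrap s RR) C)
  run⇒closes st (nop ∷ P)    e = closes-prepend (nopˡ empty) (run⇒closes st P e)
  run⇒closes []       (pop s ∷ P) ()
  run⇒closes (t ∷ st) (pop s ∷ P) e with s ≟ₛ t
  run⇒closes (t ∷ st) (pop s ∷ P) e  | yes refl = popped empty (run⇒closes st P e)
  run⇒closes (t ∷ st) (pop s ∷ P) () | no  _

  realizable⇔run : ∀ {P} → Realizable P ⇔ (run [] P ≡ just [])
  realizable⇔run {P} = mk⇔ (λ R → realizable⇒run R []) complete
    where
    complete : run [] P ≡ just [] → Realizable P
    complete e with closed R ← run⇒closes [] P e = R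

module NopFreeEncoding {m : ℕ} where

  firstHalf secondHalf : Op (Fin m) → Op (Fin (suc m))
  firstHalf (push s) = push (suc s)
  firstHalf (pop s)  = pop zero
  firstHalf nop      = push zero
  secondHalf (push s) = push zero
  secondHalf (pop s)  = pop (suc s)
  secondHalf nop      = pop zero

  halves-not-nop : ∀ o → ¬ firstHalf o ≡ nop × ¬ secondHalf o ≡ nop
  halves-not-nop (push s) = (λ ()) , (λ ())
  halves-not-nop (pop s)  = (λ ()) , (λ ())
  halves-not-nop nop      = (λ ()) , (λ ())

  encode : List (Op (Fin m)) → List (Op (Fin (suc m)))
  encode []      = []
  encode (o ∷ P) = firstHalf o ∷ secondHalf o ∷ encode P

  open StackMachine {Fin m} _≟_ using () renaming (run to run₀; realizable⇔run to realizable⇔run₀)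
  open StackMachine {Fin (suc m)} _≟_ using () renaming (run to run₁; realizable⇔run to realizable⇔run₁)

  encodeStack : List (Fin m) → List (Fin (suc m))
  encodeStack []       = []
  encodeStack (s ∷ st) = zero ∷ suc s ∷ encodeStack st

  run-encode : ∀ st P → run₁ (encodeStack st) (encode P) ≡ Maybe.map encodeStack (run₀ st P)
  run-encode st       []           = refl
  run-encode st       (push s ∷ P) = run-encode (s ∷ st) P
  run-encode st       (nop ∷ P)    = run-encode st P
  run-encode []       (pop s ∷ P)  = refl
  run-encode (t ∷ st) (pop s ∷ P) with s ≟ t
  ... | yes _ = run-encode st P
  ... | no  _ = refl

  encodeStack-empty : ∀ {r} → Maybe.map encodeStack r ≡ just [] → r ≡ just []
  encodeStack-empty {just []}      _  = refl
  encodeStack-empty {just (_ ∷ _)} ()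
  encodeStack-empty {nothing}      ()

  encode-realizable : ∀ P → Realizable (encode P) ⇔ Realizable P
  encode-realizable P = mk⇔
    (λ R → from realizable⇔run₀ (encodeStack-empty (trans (sym (run-encode [] P)) (to realizable⇔run₁ R))))
    (λ R → from realizable⇔run₁ (trans (run-encode [] P) (cong (Maybe.map encodeStack) (to realizable⇔run₀ R))))
    where open Equivalence

length-insert : ∀ {A : Set} (ys₁ : List A) x ys₂ → length (ys₁ ++ x ∷ ys₂) ≡ suc (length (ys₁ ++ ys₂))
length-insert []        x ys₂ = refl
length-insert (y ∷ ys₁) x ys₂ = cong suc (length-insert ys₁ x ys₂)

unique-⊆-length : ∀ {A : Set} {xs ys : List A} → Unique xs → xs ⊆ ys → length xs ≤ length ys
unique-⊆-length {xs = []}     _          _   = z≤n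
unique-⊆-length {xs = x ∷ xs} (x∉xs ∷ U) sub with ys₁ , ys₂ , refl ← ∈-∃++ (sub (here refl)) =
  ≤-trans (s≤s (unique-⊆-length U sub′)) (≤-reflexive (sym (length-insert ys₁ x ys₂)))
  where
  sub′ : xs ⊆ ys₁ ++ ys₂
  sub′ m with ∈-++⁻ ys₁ (sub (there m))
  ... | inj₁ m₁         = ∈-++⁺ˡ m₁
  ... | inj₂ (here refl) = ⊥-elim (lookup x∉xs m refl)
  ... | inj₂ (there m₂)  = ∈-++⁺ʳ ys₁ m₂

count-≤ : ∀ {n} {B : Set} {P : Pred (Fin n) Level.zero} (P? : Decidable P) (f : Fin n → B) →
          Injective _≡_ _≡_ f → (ys : List B) → (∀ x → P x → f x ∈ ys) →
          length (filter P? (allFin n)) ≤ length ys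
count-≤ {n} P? f f-inj ys into = begin
  length (filter P? (allFin n))           ≡⟨ length-map f (filter P? (allFin n)) ⟨
  length (map f (filter P? (allFin n)))   ≤⟨ unique-⊆-length unique image⊆ys ⟩
  length ys                               ∎
  where
  open ≤-Reasoning
  unique : Unique (map f (filter P? (allFin n)))
  unique = Unique.map⁺ f-inj (Unique.filter⁺ P? (Unique.allFin⁺ n))
  image⊆ys : map f (filter P? (allFin n)) ⊆ ys
  image⊆ys m with x , x∈ , refl ← ∈-map⁻ f m = into x (proj₂ (∈-filter⁻ P? {xs = allFin n} x∈))

length-cartesianProduct : ∀ {A B : Set} (xs : List A) (ys : List B) →
                          length (cartesianProduct xs ys) ≡ length xs * length ys
length-cartesianProduct []       ys = refl
length-cartesianProduct (x ∷ xs) ys = begin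
  length (map (x ,_) ys ++ cartesianProduct xs ys)       ≡⟨ length-++ (map (x ,_) ys) ⟩
  length (map (x ,_) ys) + length (cartesianProduct xs ys)
    ≡⟨ cong₂ _+_ (length-map (x ,_) ys) (length-cartesianProduct xs ys) ⟩
  length ys + length xs * length ys                       ∎
  where open ≡-Reasoning

parity-split : ∀ i → (∃ λ j → i ≡ j * 2) ⊎ (∃ λ j → i ≡ suc (j * 2))
parity-split ℕ.zero  = inj₁ (ℕ.zero , refl)
parity-split (suc i) with parity-split i
... | inj₁ (j , refl) = inj₂ (j , refl)
... | inj₂ (j , refl) = inj₁ (suc j , refl)

double-injective : ∀ m n → m * 2 ≡ n * 2 → m ≡ n
double-injective m n = *-cancelʳ-≡ m n 2

odd≢even : ∀ m n → ¬ suc (m * 2) ≡ n * 2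
odd≢even m n eq = even≢odd n m (trans (*-comm 2 n) (trans (sym eq) (cong suc (*-comm m 2))))

module _ {c ℓ : Level} {F : Field c ℓ} (G G′ : SBP F) where
  open Polynomials F
  open Equivalence

  record PathCorrespondence : Set (c Level.⊔ ℓ) where
    field
      translate           : List (Fin (SBP.size G)) → List (Fin (SBP.size G′))
      translate-injective : Injective _≡_ _≡_ translate
      realizable⇔         : ∀ ws → StackRealizablePath G ws ⇔ StackRealizablePath G′ (translate ws)
      realizable-onto     : ∀ {ws′} → StackRealizablePath G′ ws′ → ∃ λ ws → ws′ ≡ translate ws
      weight-preserved    : ∀ ws → pathWeight G ws ≈P pathWeight G′ (translate ws)

  correspondence⇒sameFunction : PathCorrespondence → SameFunction G G′
  correspondence⇒sameFunction corr p = forth , back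
    where
    open PathCorrespondence corr

    sum-translate : ∀ L → sumPoly G (map (pathWeight G) L) ≈P sumPoly G′ (map (pathWeight G′) (map translate L))
    sum-translate []       = ≈refl
    sum-translate (ws ∷ L) = ⊕-cong (weight-preserved ws) (sum-translate L)

    enumerates-translated : ∀ {L} → (∀ ws → StackRealizablePath G ws ⇔ ws ∈ L) →
                            ∀ ws′ → StackRealizablePath G′ ws′ ⇔ ws′ ∈ map translate L
    enumerates-translated {L} enum ws′ = mk⇔
      (λ srp → let ws , eq = realizable-onto srp in
        subst (_∈ map translate L) (sym eq)
          (∈-map⁺ translate (to (enum ws) (from (realizable⇔ ws) (subst (StackRealizablePath G′) eq srp)))))
      (λ mem → let ws , ws∈L , eq = ∈-map⁻ translate mem in
        subst (StackRealizablePath G′) (sym eq) (to (realizable⇔ ws) (from (enum ws) ws∈L)))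

    preimage : ∀ L′ → (∀ {ws′} → ws′ ∈ L′ → StackRealizablePath G′ ws′) → ∃ λ L → L′ ≡ map translate L
    preimage []         _   = [] , refl
    preimage (ws′ ∷ L′) srp with ws , refl ← realizable-onto (srp (here refl))
                             | L , refl ← preimage L′ (λ m → srp (there m)) = ws ∷ L , refl

    forth : Computes G p → Computes G′ p
    forth (L , unique , enum , p≈) =
      map translate L , Unique.map⁺ translate-injective unique , enumerates-translated enum ,
      ≈trans p≈ (sum-translate L)

    back : Computes G′ p → Computes G p
    back (L′ , unique′ , enum′ , p≈) with L , refl ← preimage L′ (λ {ws′} → from (enum′ ws′)) =
      L , Unique.map⁻ unique′ , enum , ≈trans p≈ (≈sym (sum-translate L))
      where
      enum : ∀ ws → StackRealizablePath G ws ⇔ ws ∈ L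
      enum ws = mk⇔
        (λ srp → let ws₀ , ws₀∈L , eq = ∈-map⁻ translate (to (enum′ (translate ws)) (to (realizable⇔ ws) srp)) in
          subst (_∈ L) (sym (translate-injective eq)) ws₀∈L)
        (λ ws∈L → from (realizable⇔ ws) (from (enum′ (translate ws)) (∈-map⁺ translate ws∈L)))

module _ {c ℓ : Level} {F : Field c ℓ} (G : SBP F) where
  open SBP G
  open Polynomials F

  opsFrom : Fin size → List (Fin size) → List (Op (Fin symbols))
  opsFrom u ws = map (λ e → σ (proj₁ e) (proj₂ e)) (edgesOf u ws)

  weightFrom : Fin size → List (Fin size) → Poly
  weightFrom u ws = foldr (λ e p → weightPoly G (w (proj₁ e) (proj₂ e)) ⊗ p) (con (Field.1# F)) (edgesOf u ws)

weightPoly-independent : ∀ {c ℓ} {F : Field c ℓ} (G H : SBP F) x → weightPoly G x ≡ weightPoly H x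
weightPoly-independent G H (const a) = refl
weightPoly-independent G H (X i)     = refl

walk-snoc : ∀ {n} {R : Fin n → Fin n → Bool} {a ws b c} → IsWalk R a ws b → R b c ≡ true →
            IsWalk R a (ws ++ c ∷ []) c
walk-snoc here       e′ = step e′ here
walk-snoc (step e W) e′ = step e (walk-snoc W e′)

module Subdivision {c ℓ : Level} {F : Field c ℓ} (G : SBP F) where
  open SBP G
  open Polynomials F
  open NopFreeEncoding {symbols}

  Vertex : Set
  Vertex = Fin size ⊎ (Fin size × Fin size)

  N : ℕ
  N = size + size * size

  decode : Fin N → Vertex
  decode x = Sum.map₂ (remQuot size) (splitAt size x)

  encodeV : Vertex → Fin N
  encodeV v = join size (size * size) (Sum.map₂ (uncurry combine) v)

  decode-encodeV : ∀ v → decode (encodeV v) ≡ v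
  decode-encodeV (inj₁ u) rewrite splitAt-join size (size * size) (inj₁ u) = refl
  decode-encodeV (inj₂ (a , b))
    rewrite splitAt-join size (size * size) (inj₂ (combine a b)) | remQuot-combine {size} {size} a b = refl

  encodeV-decode : ∀ x → encodeV (decode x) ≡ x
  encodeV-decode x with splitAt size x in eq
  ... | inj₁ u = trans (cong (join size (size * size)) (sym eq)) (join-splitAt size (size * size) x)
  ... | inj₂ y = trans (cong (λ z → join size (size * size) (inj₂ z)) (combine-remQuot {size} size y))
                       (trans (cong (join size (size * size)) (sym eq)) (join-splitAt size (size * size) x))

  decode⇒≡ : ∀ {x v} → decode x ≡ v → x ≡ encodeV v
  decode⇒≡ {x} refl = sym (encodeV-decode x)

  decode-injective : Injective _≡_ _≡_ decode
  decode-injective {x} {y} eq = trans (sym (encodeV-decode x)) (trans (cong encodeV eq) (encodeV-decode y))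

  encodeV-injective : Injective _≡_ _≡_ encodeV
  encodeV-injective {v} {v′} eq = trans (sym (decode-encodeV v)) (trans (cong decode eq) (decode-encodeV v′))

  original : Fin size → Fin N
  original u = encodeV (inj₁ u)

  midpoint : Fin size → Fin size → Fin N
  midpoint a b = encodeV (inj₂ (a , b))

  original-injective : Injective _≡_ _≡_ original
  original-injective {u} {v} eq with refl ← encodeV-injective {inj₁ u} {inj₁ v} eq = refl

  midpoint≢original : ∀ a b u → ¬ midpoint a b ≡ original u
  midpoint≢original a b u eq with () ← encodeV-injective {inj₂ (a , b)} {inj₁ u} eq

  vertexAdj : Vertex → Vertex → Bool
  vertexAdj (inj₁ u)       (inj₂ (a , b)) = does (u ≟ a) ∧ adj a b
  vertexAdj (inj₂ (a , b)) (inj₁ v)       = does (b ≟ v) ∧ adj a b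
  vertexAdj _              _              = false

  vertexAdj-original : ∀ {u v} → vertexAdj (inj₁ u) v ≡ true → ∃ λ b → v ≡ inj₂ (u , b) × adj u b ≡ true
  vertexAdj-original {u} {inj₂ (a , b)} e with u ≟ a
  vertexAdj-original {u} {inj₂ (a , b)} e  | yes refl = b , refl , e
  vertexAdj-original {u} {inj₂ (a , b)} () | no _

  vertexAdj-midpoint : ∀ {a b v} → vertexAdj (inj₂ (a , b)) v ≡ true → v ≡ inj₁ b × adj a b ≡ true
  vertexAdj-midpoint {a} {b} {inj₁ v} e with b ≟ v
  vertexAdj-midpoint {a} {b} {inj₁ v} e  | yes refl = refl , e
  vertexAdj-midpoint {a} {b} {inj₁ v} () | no _

  vertexWeight : Vertex → Vertex → Weight F
  vertexWeight (inj₁ _) (inj₂ (a , b)) = w a b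
  vertexWeight _        _              = const (Field.1# F)

  -- the value on non-edges is irrelevant
  vertexOp : Vertex → Vertex → Op (Fin (suc symbols))
  vertexOp (inj₁ _)       (inj₂ (a , b)) = firstHalf (σ a b)
  vertexOp (inj₂ (a , b)) (inj₁ _)       = secondHalf (σ a b)
  vertexOp _              _              = nop

  adj′ : Fin N → Fin N → Bool
  adj′ x y = vertexAdj (decode x) (decode y)

  adj′-original-midpoint : ∀ u v → adj′ (original u) (midpoint u v) ≡ adj u v
  adj′-original-midpoint u v rewrite decode-encodeV (inj₁ u) | decode-encodeV (inj₂ (u , v)) | dec-true (u ≟ u) refl = refl

  adj′-midpoint-original : ∀ u v → adj′ (midpoint u v) (original v) ≡ adj u v
  adj′-midpoint-original u v rewrite decode-encodeV (inj₂ (u , v)) | decode-encodeV (inj₁ v) | dec-true (v ≟ v) refl = refl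

  adj′-from-original : ∀ {u y} → adj′ (original u) y ≡ true → ∃ λ b → y ≡ midpoint u b × adj u b ≡ true
  adj′-from-original {u} {y} e rewrite decode-encodeV (inj₁ u) with b , eq , eb ← vertexAdj-original e = b , decode⇒≡ eq , eb

  adj′-from-midpoint : ∀ {a b y} → adj′ (midpoint a b) y ≡ true → y ≡ original b × adj a b ≡ true
  adj′-from-midpoint {a} {b} e rewrite decode-encodeV (inj₂ (a , b)) with eq , eb ← vertexAdj-midpoint e = decode⇒≡ eq , eb

  subdivide : Fin size → List (Fin size) → List (Fin N)
  subdivide u []       = []
  subdivide u (v ∷ ws) = midpoint u v ∷ original v ∷ subdivide v ws

  subdivide-injective : ∀ u {ws ws′} → subdivide u ws ≡ subdivide u ws′ → ws ≡ ws′
  subdivide-injective u {[]}    {[]}      eq = refl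
  subdivide-injective u {v ∷ ws} {v′ ∷ ws′} eq
    with eq₁ , eq₂ ← ∷-injective (proj₂ (∷-injective eq))
    with refl ← original-injective eq₁ = cong (v ∷_) (subdivide-injective v eq₂)

  subdivide-walk : ∀ {u ws t} → IsWalk adj u ws t → IsWalk adj′ (original u) (subdivide u ws) (original t)
  subdivide-walk here = here
  subdivide-walk {u} (step {w = v} e W) =
    step (trans (adj′-original-midpoint u v) e) (step (trans (adj′-midpoint-original u v) e) (subdivide-walk W))

  lift-walk : ∀ {x ws′ y} u t → x ≡ original u → y ≡ original t → IsWalk adj′ x ws′ y →
              ∃ λ ws → ws′ ≡ subdivide u ws × IsWalk adj u ws t
  lift-walk u t ex ey here with refl ← original-injective (trans (sym ex) ey) = [] , refl , here
  lift-walk u t refl ey (step e here)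
    with b , refl , _ ← adj′-from-original e = ⊥-elim (midpoint≢original u b t ey)
  lift-walk u t refl ey (step e₁ (step e₂ W))
    with b , refl , eb ← adj′-from-original e₁
    with refl , _ ← adj′-from-midpoint e₂
    with ws , refl , W₀ ← lift-walk b t refl ey W = b ∷ ws , refl , step eb W₀

  acyclic′ : ∀ x ws′ → IsWalk adj′ x ws′ x → ws′ ≡ []
  acyclic′ x ws′ W with decode x in ex
  ... | inj₁ u with ws , eq , W₀ ← lift-walk u u (decode⇒≡ ex) (decode⇒≡ ex) W =
    trans eq (cong (subdivide u) (acyclic u ws W₀))
  acyclic′ x .[] here | inj₂ (a , b) = refl
  acyclic′ x (y ∷ ws′) (step e W) | inj₂ (a , b)
    with refl ← decode⇒≡ ex
    with refl , _ ← adj′-from-midpoint e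
    with ws , eq , W₀ ← lift-walk b b refl refl (walk-snoc W e)
    with () ← ++-conicalʳ ws′ (y ∷ []) (trans eq (cong (subdivide b) (acyclic b ws W₀)))

  subdivided : SBP F
  subdivided = record
    { size = N ; symbols = suc symbols ; src = original src ; tgt = original tgt
    ; adj = adj′ ; w = λ x y → vertexWeight (decode x) (decode y) ; σ = λ x y → vertexOp (decode x) (decode y)
    ; acyclic = acyclic′ }

  subdivided-noNop : NoNopEdges subdivided
  subdivided-noNop x y = edge-not-nop (decode x) (decode y)
    where
    edge-not-nop : ∀ v v′ → vertexAdj v v′ ≡ true → ¬ vertexOp v v′ ≡ nop
    edge-not-nop (inj₁ _)       (inj₂ (a , b)) _ = proj₁ (halves-not-nop (σ a b))
    edge-not-nop (inj₂ (a , b)) (inj₁ _)       _ = proj₂ (halves-not-nop (σ a b))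
    edge-not-nop (inj₁ _)       (inj₁ _)       ()
    edge-not-nop (inj₂ _)       (inj₂ _)       ()

  ops-subdivide : ∀ u ws → opsFrom subdivided (original u) (subdivide u ws) ≡ encode (opsFrom G u ws)
  ops-subdivide u []       = refl
  ops-subdivide u (v ∷ ws) =
    cong₂ _∷_ (cong₂ vertexOp (decode-encodeV (inj₁ u)) (decode-encodeV (inj₂ (u , v))))
      (cong₂ _∷_ (cong₂ vertexOp (decode-encodeV (inj₂ (u , v))) (decode-encodeV (inj₁ v)))
        (ops-subdivide v ws))

  weight-subdivide : ∀ u ws → weightFrom G u ws ≈P weightFrom subdivided (original u) (subdivide u ws)
  weight-subdivide u []       = ≈refl
  weight-subdivide u (v ∷ ws) =
    ⊗-cong (≡⇒≈P first-half)
      (≈trans (weight-subdivide v ws) (≈sym (≈trans (⊗-cong (≡⇒≈P second-half) ≈refl) (⊗-idˡ _))))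
    where
    ≡⇒≈P : ∀ {p q} → p ≡ q → p ≈P q
    ≡⇒≈P refl = ≈refl
    edgeWeight : Vertex → Vertex → Poly
    edgeWeight v₁ v₂ = weightPoly subdivided (vertexWeight v₁ v₂)
    first-half : weightPoly G (w u v) ≡ edgeWeight (decode (original u)) (decode (midpoint u v))
    first-half = trans (weightPoly-independent G subdivided (w u v))
      (sym (cong₂ edgeWeight (decode-encodeV (inj₁ u)) (decode-encodeV (inj₂ (u , v)))))
    second-half : edgeWeight (decode (midpoint u v)) (decode (original v)) ≡ con (Field.1# F)
    second-half = cong (λ v₁ → edgeWeight v₁ (decode (original v))) (decode-encodeV (inj₂ (u , v)))

  subdivision-correspondence : PathCorrespondence G subdivided
  subdivision-correspondence = record
    { translate           = subdivide src
    ; translate-injective = subdivide-injective src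
    ; realizable⇔         = λ ws → mk⇔ (forth ws) (back ws)
    ; realizable-onto     = λ (W′ , _) → let ws , eq , _ = lift-walk src tgt refl refl W′ in ws , eq
    ; weight-preserved    = weight-subdivide src }
    where
    open Equivalence
    forth : ∀ ws → StackRealizablePath G ws → StackRealizablePath subdivided (subdivide src ws)
    forth ws (W , R) = subdivide-walk W , subst Realizable (sym (ops-subdivide src ws)) (from (encode-realizable _) R)
    back : ∀ ws → StackRealizablePath subdivided (subdivide src ws) → StackRealizablePath G ws
    back ws (W′ , R′) with ws₀ , eq , W ← lift-walk src tgt refl refl W′ with refl ← subdivide-injective src eq =
      W , to (encode-realizable _) (subst Realizable (ops-subdivide src ws) R′)

  -- Layers of the subdivided program, given a layering of G: original u sits
  -- in layer 2·layer(u), a midpoint ⟨a,b⟩ with layer(b) = layer(a)+1 in the odd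
  -- layer between them, and every other midpoint (which is isolated) in a
  -- private odd layer above all the others.
  module Layering (layer : Fin size → ℕ) (layer-edge : ∀ u v → adj u v ≡ true → layer v ≡ suc (layer u)) where

    top : ℕ
    top = max 0 (map layer (allFin size))

    layer≤top : ∀ u → layer u ≤ top
    layer≤top u = lookup (xs≤max 0 (map layer (allFin size))) (∈-map⁺ layer (∈-allFin u))

    vertexLayer : ℕ → Vertex → ℕ
    vertexLayer n (inj₁ u) = layer u * 2
    vertexLayer n (inj₂ (a , b)) with layer b ℕ.≟ suc (layer a)
    ... | yes _ = suc (layer a * 2)
    ... | no  _ = suc ((suc top + n) * 2)

    layer′ : Fin N → ℕ
    layer′ x = vertexLayer (toℕ x) (decode x)

    layer′-edge : ∀ x y → adj′ x y ≡ true → layer′ y ≡ suc (layer′ x)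
    layer′-edge x y = edge-layers (toℕ x) (toℕ y) (decode x) (decode y)
      where
      edge-layers : ∀ n n′ v v′ → vertexAdj v v′ ≡ true → vertexLayer n′ v′ ≡ suc (vertexLayer n v)
      edge-layers n n′ (inj₁ u) v′ e
        with b , refl , eb ← vertexAdj-original {u} {v′} e with layer b ℕ.≟ suc (layer u)
      ... | yes _  = refl
      ... | no  ne = ⊥-elim (ne (layer-edge u b eb))
      edge-layers n n′ (inj₂ (a , b)) v′ e
        with refl , eb ← vertexAdj-midpoint {a} {b} {v′} e with layer b ℕ.≟ suc (layer a)
      ... | yes eq = cong (_* 2) eq
      ... | no  ne = ⊥-elim (ne (layer-edge a b eb))

    members : ℕ → List (Fin size)
    members i = filter (λ v → layer v ℕ.≟ i) (allFin size)

    members⁺ : ∀ {u i} → layer u ≡ i → u ∈ members i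
    members⁺ {u} = ∈-filter⁺ (λ v → layer v ℕ.≟ _) {xs = allFin size} (∈-allFin u)

    in-even-layer : ∀ n v j → vertexLayer n v ≡ j * 2 → v ∈ map inj₁ (members j)
    in-even-layer n (inj₁ u) j eq = ∈-map⁺ inj₁ (members⁺ (double-injective (layer u) j eq))
    in-even-layer n (inj₂ (a , b)) j eq with layer b ℕ.≟ suc (layer a)
    ... | yes _ = ⊥-elim (odd≢even (layer a) j eq)
    ... | no  _ = ⊥-elim (odd≢even (suc top + n) j eq)

    in-low-odd-layer : ∀ n v j → j ≤ top → vertexLayer n v ≡ suc (j * 2) →
                       v ∈ map inj₂ (cartesianProduct (members j) (members (suc j)))
    in-low-odd-layer n (inj₁ u) j _ eq = ⊥-elim (odd≢even j (layer u) (sym eq))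
    in-low-odd-layer n (inj₂ (a , b)) j j≤top eq with layer b ℕ.≟ suc (layer a)
    ... | yes eb with refl ← double-injective (layer a) j (suc-injective eq) =
      ∈-map⁺ inj₂ (∈-cartesianProduct⁺ (members⁺ refl) (members⁺ eb))
    ... | no  _ with refl ← double-injective (suc top + n) j (suc-injective eq) =
      ⊥-elim (<⇒≱ (s≤s (m≤m+n top n)) j≤top)

    in-high-odd-layer : ∀ n v j → top < j → vertexLayer n v ≡ suc (j * 2) → n ∈ (j ∸ suc top) ∷ []
    in-high-odd-layer n (inj₁ u) j _ eq = ⊥-elim (odd≢even j (layer u) (sym eq))
    in-high-odd-layer n (inj₂ (a , b)) j top<j eq with layer b ℕ.≟ suc (layer a)
    ... | yes _ with refl ← double-injective (layer a) j (suc-injective eq) = ⊥-elim (<⇒≱ top<j (layer≤top a))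
    ... | no  _ with refl ← double-injective (suc top + n) j (suc-injective eq) = here (sym (m+n∸m≡n (suc top) n))

    module Width (k : ℕ) (width : ∀ i → length (members i) ≤ k) where

      -- the source occupies a layer, so k ≥ 1
      k-positive : 1 ≤ k
      k-positive = ≤-trans (nonempty-length (members⁺ {src} refl)) (width (layer src))
        where
        nonempty-length : ∀ {A : Set} {x : A} {xs} → x ∈ xs → 1 ≤ length xs
        nonempty-length (here _)  = s≤s z≤n
        nonempty-length (there _) = s≤s z≤n

      k≤k*k : k ≤ k * k
      k≤k*k = m≤m*n k k {{>-nonZero k-positive}}

      -- an even layer 2j holds originals from layer j of G, a low odd layer 2j+1
      -- pairs from layers j and j+1, and a high odd layer a single midpoint
      width′ : ∀ i → length (filter (λ x → layer′ x ℕ.≟ i) (allFin N)) ≤ k * k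
      width′ i with parity-split i
      ... | inj₁ (j , refl) = begin
        _                                ≤⟨ count-≤ _ decode decode-injective _ (λ x → in-even-layer (toℕ x) (decode x) j) ⟩
        length (map inj₁ (members j))    ≡⟨ length-map inj₁ (members j) ⟩
        length (members j)               ≤⟨ width j ⟩
        k                                ≤⟨ k≤k*k ⟩
        k * k                            ∎
        where open ≤-Reasoning
      ... | inj₂ (j , refl) with j ℕ.≤? top
      ...   | yes j≤top = begin
        _  ≤⟨ count-≤ _ decode decode-injective _ (λ x → in-low-odd-layer (toℕ x) (decode x) j j≤top) ⟩
        length (map inj₂ (cartesianProduct (members j) (members (suc j))))
           ≡⟨ trans (length-map inj₂ (cartesianProduct (members j) (members (suc j))))
                    (length-cartesianProduct (members j) (members (suc j))) ⟩
        length (members j) * length (members (suc j))  ≤⟨ *-mono-≤ (width j) (width (suc j)) ⟩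
        k * k                                          ∎
        where open ≤-Reasoning
      ...   | no  j≰top = begin
        _      ≤⟨ count-≤ _ toℕ toℕ-injective _ (λ x → in-high-odd-layer (toℕ x) (decode x) j (≰⇒> j≰top)) ⟩
        1      ≤⟨ ≤-trans k-positive k≤k*k ⟩
        k * k  ∎
        where open ≤-Reasoning

  subdivided-layered : ∀ k → Layered G k → Layered subdivided (k * k)
  subdivided-layered k (layer , layer-edge , width) =
    layer′ , layer′-edge , width′
    where open Layering layer layer-edge
          open Width k width

size-bound : ∀ n → Fin n → n + n * n ≤ 2 * (n * n)
size-bound n@(suc _) _ = begin
  n + n * n        ≤⟨ +-monoˡ-≤ (n * n) (m≤m*n n n) ⟩
  n * n + n * n    ≡⟨ cong (n * n +_) (+-identityʳ (n * n)) ⟨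
  2 * (n * n)      ∎
  where open ≤-Reasoning

proposition8 : ∀ {c ℓ : Level} → Σ ℕ λ C → ∀ (F : Field c ℓ) (G : SBP F) → Σ (SBP F) λ G' → (SBP.size G' ≤ C * (SBP.size G * SBP.size G)) × SameFunction G G' × NoNopEdges G' × (∀ k → Layered G k → Layered G' (k * k))
proposition8 = 2 , λ F G → let open Subdivision G in
  subdivided ,
  size-bound (SBP.size G) (SBP.src G) ,
  correspondence⇒sameFunction G subdivided subdivision-correspondence ,
  subdivided-noNop ,
  subdivided-layered
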